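{- Let $\{G_k\}$ be an ascending sequence of graphs such that there exists a subsequence $\{G_{k_j}\}$ that is a Ramsey sequence. Then the sequence $\{G_k\}$ itself is a Ramsey sequence.
   Context: A sequence of graphs $\{H_k\}$ is ascending if $H_k$ is isomorphic to a proper subgraph of $H_{k+1}$ for every positive integer $k$. An ascending sequence $\{H_k\}$ is a Ramsey sequence if for every positive integer $k$ there exists an integer $n>k$ such that every red-blue coloring of the edges of $H_n$ contains a monochromatic (all red or all blue) subgraph isomorphic to $H_k$. A subsequence $\{G_{k_j}\}$ is taken with $k_1<k_2<\cdots$. -}

module Defs where

open import Data.Nat using (ℕ; suc; _<_; _≤_)
open import Data.Fin using (Fin)
open import Data.Bool using (Bool; true; false)
open import Data.Product using (Σ; ∃; _×_; _,_)
open import Data.Sum using (_⊎_)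
open import Relation.Binary.PropositionalEquality using (_≡_; _≢_)
open import Relation.Nullary using (¬_)
open import Function.Definitions using (Injective)

record Graph : Set where
  field
    n    : ℕ
    adj  : Fin n → Fin n → Bool
    sym  : ∀ u v → adj u v ≡ adj v u
    irr  : ∀ v → adj v v ≡ false
open Graph public

Edge : (G : Graph) → Fin (n G) → Fin (n G) → Set
Edge G u v = adj G u v ≡ true

-- An embedding of H into G: an injective vertex map sending edges to edges.
-- Its image is a subgraph of G isomorphic to H, and every subgraph of G
-- isomorphic to H arises this way.
record Embedding (H G : Graph) : Set where
  field
    map  : Fin (n H) → Fin (n G)
    inj  : Injective _≡_ _≡_ map
    hom  : ∀ u v → Edge H u v → Edge G (map u) (map v)
open Embedding public

_⊆ᵍ_ : Graph → Graph → Set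
H ⊆ᵍ G = Embedding H G

_⊂ᵍ_ : Graph → Graph → Set
H ⊂ᵍ G = Σ (Embedding H G) λ e →
  (Σ (Fin (n G)) λ w → ∀ v → map e v ≢ w)
  ⊎ (Σ (Fin (n G)) λ x → Σ (Fin (n G)) λ y → Edge G x y ×
       (∀ u v → map e u ≡ x → map e v ≡ y → ¬ Edge H u v))

-- A red-blue edge colouring of G (true = red, false = blue), symmetric so
-- it is a colouring of unordered edges (values on non-edges are irrelevant).
record Colouring (G : Graph) : Set where
  field
    col     : Fin (n G) → Fin (n G) → Bool
    col-sym : ∀ u v → col u v ≡ col v u
open Colouring public

MonoCopy : (G : Graph) → Colouring G → Graph → Set
MonoCopy G c H = Σ Bool λ b → Σ (Embedding H G) λ e →
  ∀ u v → Edge H u v → col c (map e u) (map e v) ≡ b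

-- Sequences are indexed by ℕ, using only indices k ≥ 1 (index 0 ignored).
Ascending : (ℕ → Graph) → Set
Ascending H = ∀ k → 1 ≤ k → H k ⊂ᵍ H (suc k)

RamseySeq : (ℕ → Graph) → Set
RamseySeq H = Ascending H ×
  (∀ k → 1 ≤ k → Σ ℕ λ m → k < m × ((c : Colouring (H m)) → MonoCopy (H m) c (H k)))

StrictInc : (ℕ → ℕ) → Set
StrictInc κ = (1 ≤ κ 1) × (∀ j → 1 ≤ j → κ j < κ (suc j))

module Submission where

open import Defs
open import Data.Nat using (ℕ; zero; suc; _≤_; _<_; _≤′_; ≤′-refl; ≤′-step; s≤s; z≤n)
open import Data.Nat.Properties using (≤⇒≤′; ≤′⇒≤; ≤-trans; <-trans; ≤-<-trans; n≤1+n)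
open import Data.Product using (Σ; _×_; _,_; proj₁; proj₂)
open import Function using (_∘_)

-- Given k, the subsequence yields m with G (κ m) arrowing G (κ k). Since k ≤ κ k,
-- the ascending chain embeds G k into G (κ k), so every monochromatic copy of
-- G (κ k) contains one of G k; and k ≤ κ k < κ m.

⊆ᵍ-refl : ∀ {H} → H ⊆ᵍ H
⊆ᵍ-refl = record { map = λ v → v ; inj = λ eq → eq ; hom = λ _ _ uv → uv }

⊆ᵍ-trans : ∀ {H K G} → H ⊆ᵍ K → K ⊆ᵍ G → H ⊆ᵍ G
⊆ᵍ-trans f g = record
  { map = map g ∘ map f
  ; inj = λ eq → inj f (inj g eq)
  ; hom = λ u v uv → hom g _ _ (hom f u v uv)
  }

monoCopy-⊆ᵍ : ∀ {G H K} (c : Colouring G) → K ⊆ᵍ H → MonoCopy G c H → MonoCopy G c K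
monoCopy-⊆ᵍ c f (b , e , mono) = b , ⊆ᵍ-trans f e , λ u v uv → mono _ _ (hom f u v uv)

ascending-⊆ᵍ : ∀ {G} → Ascending G → ∀ {a b} → 1 ≤ a → a ≤ b → G a ⊆ᵍ G b
ascending-⊆ᵍ {G} asc {a} 1≤a a≤b = go (≤⇒≤′ a≤b)
  where
  go : ∀ {b} → a ≤′ b → G a ⊆ᵍ G b
  go ≤′-refl = ⊆ᵍ-refl
  go (≤′-step a≤′b) = ⊆ᵍ-trans (go a≤′b) (proj₁ (asc _ (≤-trans 1≤a (≤′⇒≤ a≤′b))))

module _ {κ : ℕ → ℕ} (inc : StrictInc κ) where

  strictInc-mono : ∀ {a b} → 1 ≤ a → a < b → κ a < κ b
  strictInc-mono {a} 1≤a a<b = go (≤⇒≤′ a<b)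
    where
    go : ∀ {b} → suc a ≤′ b → κ a < κ b
    go ≤′-refl = proj₂ inc a 1≤a
    go (≤′-step a<′b) = <-trans (go a<′b) (proj₂ inc _ (≤-trans 1≤a (≤-trans (n≤1+n a) (≤′⇒≤ a<′b))))

  strictInc-inflationary : ∀ k → 1 ≤ k → k ≤ κ k
  strictInc-inflationary (suc zero)    _ = proj₁ inc
  strictInc-inflationary (suc (suc k)) _ =
    ≤-trans (s≤s (strictInc-inflationary (suc k) (s≤s z≤n))) (proj₂ inc (suc k) (s≤s z≤n))

mainTheorem3 : (G : ℕ → Graph) → Ascending G →
    (Σ (ℕ → ℕ) λ κ → StrictInc κ × RamseySeq (G ∘ κ)) →
    RamseySeq G
mainTheorem3 G asc (κ , inc , _ , ramsey) = asc , ramseyAt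
  where
  ramseyAt : ∀ k → 1 ≤ k → Σ ℕ λ m → k < m × ((c : Colouring (G m)) → MonoCopy (G m) c (G k))
  ramseyAt k 1≤k with ramsey k 1≤k
  ... | m , k<m , arrows =
    κ m , ≤-<-trans k≤κk (strictInc-mono inc 1≤k k<m)
        , λ c → monoCopy-⊆ᵍ c (ascending-⊆ᵍ asc 1≤k k≤κk) (arrows c)
    where
    k≤κk : k ≤ κ k
    k≤κk = strictInc-inflationary inc k 1≤k
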